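{- Let $\Gamma$ be a finite set of formulae of intuitionistic propositional logic and $\phi$ a formula. If $\Gamma\models\phi$, i.e. there exists a natural transformation $\llbracket\Gamma\rrbracket\to\llbracket\phi\rrbracket$ of presheaves on $\mathcal W$, then $\Gamma\vdash\phi$ is derivable in NJ.
   Context: Fix a countable set $\mathbb A$ of atoms; formulae are built from atoms and $\bot$ with $\wedge,\vee,\supset$. NJ is the standard natural deduction calculus for intuitionistic propositional logic in sequent form. An atomic rule is $\mathcal R=((P_1\Rightarrow q_1),\dots,(P_n\Rightarrow q_n))\Rightarrow r$ with $n\ge0$, $P_i$ finite sets of atoms, $q_i,r$ atoms. A base is a countable set of atomic rules. A context $(X:P)$ is a finite list $x_1:p_1,\dots,x_m:p_m$ of distinct variables with atoms. Derivation terms are $\Phi::=x\mid\Phi_{\mathcal R}(\Phi_1,\dots,\Phi_n)$; derivations in a base $\mathcal B$ are generated by (Ref) $(X:P),x:p\vdash_{\mathcal B}x:p$ and (App) if $\mathcal R\in\mathcal B$ and $(X:P),(X_i:P_i)\vdash_{\mathcal B}\Phi_i:q_i$ for all $i$, then $(X:P)\vdash_{\mathcal B}\Phi_{\mathcal R}(\Phi_1,\dots,\Phi_n):r$ (the $X_i$ bound). The category $\mathcal W$ has objects $(\mathcal B,(X:P))$; a morphism $(\mathcal B,(X:P))\to(\mathcal C,(Y:Q))$, $Y:Q=y_1:q_1,\dots,y_m:q_m$, exists only when $\mathcal C\subseteq\mathcal B$ and is a tuple of derivations $(X:P)\vdash_{\mathcal B}\Phi_i:q_i$; identities are variable tuples,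 composition is simultaneous substitution. For presheaves $F,G$ on $\mathcal W$: $F\times G$ pointwise; $(F\supset G)(w)=$ natural transformations $\mathcal W(-,w)\times F\to G$. Interpretation $\llbracket-\rrbracket$: $\llbracket p\rrbracket(\mathcal B,(X:P))$ = set of derivations $(X:P)\vdash_{\mathcal B}\Phi:p$, with action by substitution; $\llbracket\phi\wedge\psi\rrbracket=\llbracket\phi\rrbracket\times\llbracket\psi\rrbracket$; $\llbracket\phi\supset\psi\rrbracket=\llbracket\phi\rrbracket\supset\llbracket\psi\rrbracket$; $\llbracket\phi\vee\psi\rrbracket=\prod_{p\in\mathbb A}\big((\llbracket\phi\rrbracket\supset\llbracket p\rrbracket)\supset((\llbracket\psi\rrbracket\supset\llbracket p\rrbracket)\supset\llbracket p\rrbracket)\big)$; $\llbracket\bot\rrbracket=\prod_{p\in\mathbb A}\llbracket p\rrbracket$; $\llbracket\Gamma\rrbracket$ = product over $\Gamma$ (terminal if empty). -}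

module Defs where

open import Level using (0ℓ) renaming (suc to lsuc)
open import Data.Nat using (ℕ)
open import Data.List using (List; []; _∷_; _++_)
open import Data.List.Membership.Propositional using (_∈_)
open import Data.List.Relation.Unary.All using (All; []; _∷_)
open import Data.Product using (_×_; _,_; proj₁; proj₂)
open import Data.Unit.Polymorphic using (⊤; tt)
open import Relation.Binary.Bundles using (Setoid)
open import Relation.Binary.PropositionalEquality
  using (_≡_; refl; sym; trans; cong; cong₂; module ≡-Reasoning)
import Relation.Binary.PropositionalEquality as PE
open import Data.Product.Relation.Binary.Pointwise.NonDependent using (×-setoid)

Atom : Set
Atom = ℕ

infixr 6 _∧'_
infixr 5 _∨'_
infixr 4 _⊃'_

data Form : Set where
  atom  : Atom → Form
  ⊥'    : Form
  _∧'_  : Form → Form → Form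
  _∨'_  : Form → Form → Form
  _⊃'_  : Form → Form → Form

infix 2 _⊢_
data _⊢_ (Γ : List Form) : Form → Set where
  ax  : ∀ {φ} → φ ∈ Γ → Γ ⊢ φ
  ∧I  : ∀ {φ ψ} → Γ ⊢ φ → Γ ⊢ ψ → Γ ⊢ φ ∧' ψ
  ∧E₁ : ∀ {φ ψ} → Γ ⊢ φ ∧' ψ → Γ ⊢ φ
  ∧E₂ : ∀ {φ ψ} → Γ ⊢ φ ∧' ψ → Γ ⊢ ψ
  ∨I₁ : ∀ {φ ψ} → Γ ⊢ φ → Γ ⊢ φ ∨' ψ
  ∨I₂ : ∀ {φ ψ} → Γ ⊢ ψ → Γ ⊢ φ ∨' ψ
  ∨E  : ∀ {φ ψ χ} → Γ ⊢ φ ∨' ψ → (φ ∷ Γ) ⊢ χ → (ψ ∷ Γ) ⊢ χ → Γ ⊢ χ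
  ⊃I  : ∀ {φ ψ} → (φ ∷ Γ) ⊢ ψ → Γ ⊢ φ ⊃' ψ
  ⊃E  : ∀ {φ ψ} → Γ ⊢ φ ⊃' ψ → Γ ⊢ φ → Γ ⊢ ψ
  ⊥E  : ∀ {φ} → Γ ⊢ ⊥' → Γ ⊢ φ

-- Contexts (X : P): variables are de Bruijn indices into a list of atoms
Ctx : Set
Ctx = List Atom

infix 4 _∋_
data _∋_ : Ctx → Atom → Set where
  here  : ∀ {Γ p} → p ∷ Γ ∋ p
  there : ∀ {Γ p q} → Γ ∋ p → q ∷ Γ ∋ p

-- R = ((P₁ ⇒ q₁), … , (Pₙ ⇒ qₙ)) ⇒ r  is  rule ((P₁ , q₁) ∷ … ∷ (Pₙ , qₙ) ∷ []) r
record Rule : Set where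
  constructor rule
  field
    prem  : List (Ctx × Atom)
    concl : Atom
open Rule public

Base : Set₁
Base = Rule → Set

infix 4 _⊆B_
_⊆B_ : Base → Base → Set
C ⊆B B = ∀ {R} → C R → B R

variable
  Γ Δ Θ Ξ : Ctx
  B C D E : Base
  p q : Atom
  ps : List (Ctx × Atom)

-- Derivations (X:P) ⊢_B Φ : p.  Membership of the rule in the base is
-- proof-irrelevant, so a derivation is determined by its term Φ.
mutual
  data Der (B : Base) (Γ : Ctx) : Atom → Set₁ where
    var : Γ ∋ p → Der B Γ p
    app : (R : Rule) → .(B R) → Args B Γ (prem R) → Der B Γ (concl R)

  -- the premises (X:P),(Xᵢ:Pᵢ) ⊢ Φᵢ : qᵢ  (the Xᵢ are bound)
  data Args (B : Base) (Γ : Ctx) : List (Ctx × Atom) → Set₁ where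
    []  : Args B Γ []
    _∷_ : ∀ {P q ps} → Der B (P ++ Γ) q → Args B Γ ps → Args B Γ ((P , q) ∷ ps)

Ren : Ctx → Ctx → Set
Ren Γ Δ = ∀ {p} → Δ ∋ p → Γ ∋ p

extR : Ren Γ Δ → Ren (q ∷ Γ) (q ∷ Δ)
extR ρ here      = here
extR ρ (there x) = there (ρ x)

extR* : (P : Ctx) → Ren Γ Δ → Ren (P ++ Γ) (P ++ Δ)
extR* []      ρ = ρ
extR* (q ∷ P) ρ = extR (extR* P ρ)

mutual
  ren : Ren Γ Δ → Der B Δ p → Der B Γ p
  ren ρ (var x)      = var (ρ x)
  ren ρ (app R m as) = app R m (renA ρ as)

  renA : Ren Γ Δ → Args B Δ ps → Args B Γ ps
  renA ρ []               = []
  renA ρ (_∷_ {P} d as)   = ren (extR* P ρ) d ∷ renA ρ as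

Sub : Base → Ctx → Ctx → Set₁
Sub B Γ Δ = ∀ {p} → Δ ∋ p → Der B Γ p

ext : Sub B Γ Δ → Sub B (q ∷ Γ) (q ∷ Δ)
ext σ here      = var here
ext σ (there x) = ren there (σ x)

ext* : (P : Ctx) → Sub B Γ Δ → Sub B (P ++ Γ) (P ++ Δ)
ext* []      σ = σ
ext* (q ∷ P) σ = ext (ext* P σ)

mutual
  sub : .(C ⊆B B) → Sub B Γ Δ → Der C Δ p → Der B Γ p
  sub i σ (var x)      = σ x
  sub i σ (app R m as) = app R (i m) (subA i σ as)

  subA : .(C ⊆B B) → Sub B Γ Δ → Args C Δ ps → Args B Γ ps
  subA i σ []             = []
  subA i σ (_∷_ {P} d as) = sub i (ext* P σ) d ∷ subA i σ as

private
  _≗R_ : Ren Γ Δ → Ren Γ Δ → Set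
  _≗R_ {Δ = Δ} ρ ρ' = ∀ {p} (x : Δ ∋ p) → ρ x ≡ ρ' x

  _≗S_ : Sub B Γ Δ → Sub B Γ Δ → Set₁
  _≗S_ {Δ = Δ} σ σ' = ∀ {p} (x : Δ ∋ p) → σ x ≡ σ' x

  extR-cong : {ρ ρ' : Ren Γ Δ} → ρ ≗R ρ' → extR {q = q} ρ ≗R extR ρ'
  extR-cong h here      = refl
  extR-cong h (there x) = cong there (h x)

  extR*-cong : (P : Ctx) {ρ ρ' : Ren Γ Δ} → ρ ≗R ρ' → extR* P ρ ≗R extR* P ρ'
  extR*-cong []      h = h
  extR*-cong (q ∷ P) h = extR-cong (extR*-cong P h)

  mutual
    ren-cong : {ρ ρ' : Ren Γ Δ} → ρ ≗R ρ' → (d : Der B Δ p) → ren ρ d ≡ ren ρ' d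
    ren-cong h (var x)      = cong var (h x)
    ren-cong h (app R m as) = cong (app R m) (renA-cong h as)

    renA-cong : {ρ ρ' : Ren Γ Δ} → ρ ≗R ρ' → (as : Args B Δ ps) → renA ρ as ≡ renA ρ' as
    renA-cong h []             = refl
    renA-cong h (_∷_ {P} d as) = cong₂ _∷_ (ren-cong (extR*-cong P h) d) (renA-cong h as)

  extR*-comp : (P : Ctx) (ρ : Ren Γ Δ) (ρ' : Ren Δ Θ) →
               (λ {p} (x : P ++ Θ ∋ p) → extR* P ρ (extR* P ρ' x)) ≗R extR* P (λ x → ρ (ρ' x))
  extR*-comp []      ρ ρ' x         = refl
  extR*-comp (q ∷ P) ρ ρ' here      = refl
  extR*-comp (q ∷ P) ρ ρ' (there x) = cong there (extR*-comp P ρ ρ' x)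

  mutual
    ren-ren : (ρ : Ren Γ Δ) (ρ' : Ren Δ Θ) (d : Der B Θ p) →
              ren ρ (ren ρ' d) ≡ ren (λ x → ρ (ρ' x)) d
    ren-ren ρ ρ' (var x)      = refl
    ren-ren ρ ρ' (app R m as) = cong (app R m) (renA-ren ρ ρ' as)

    renA-ren : (ρ : Ren Γ Δ) (ρ' : Ren Δ Θ) (as : Args B Θ ps) →
               renA ρ (renA ρ' as) ≡ renA (λ x → ρ (ρ' x)) as
    renA-ren ρ ρ' []             = refl
    renA-ren ρ ρ' (_∷_ {P} d as) =
      cong₂ _∷_ (trans (ren-ren (extR* P ρ) (extR* P ρ') d)
                       (ren-cong (extR*-comp P ρ ρ') d))
                (renA-ren ρ ρ' as)

  ext-cong : {σ σ' : Sub B Γ Δ} → σ ≗S σ' → ext {q = q} σ ≗S ext σ'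
  ext-cong h here      = refl
  ext-cong h (there x) = cong (ren there) (h x)

  ext*-cong : (P : Ctx) {σ σ' : Sub B Γ Δ} → σ ≗S σ' → ext* P σ ≗S ext* P σ'
  ext*-cong []      h = h
  ext*-cong (q ∷ P) h = ext-cong (ext*-cong P h)

  mutual
    sub-cong : .(i : C ⊆B B) {σ σ' : Sub B Γ Δ} → σ ≗S σ' → (d : Der C Δ p) → sub i σ d ≡ sub i σ' d
    sub-cong i h (var x)      = h x
    sub-cong i h (app R m as) = cong (app R (i m)) (subA-cong i h as)

    subA-cong : .(i : C ⊆B B) {σ σ' : Sub B Γ Δ} → σ ≗S σ' → (as : Args C Δ ps) → subA i σ as ≡ subA i σ' as
    subA-cong i h []             = refl
    subA-cong i h (_∷_ {P} d as) = cong₂ _∷_ (sub-cong i (ext*-cong P h) d) (subA-cong i h as)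

  E1 : (ρ : Ren Γ Δ) (σ : Sub B Δ Θ) (τ : Sub B Γ Θ) →
       (∀ {p} (x : Θ ∋ p) → ren ρ (σ x) ≡ τ x) →
       ∀ {p} (x : q ∷ Θ ∋ p) → ren (extR ρ) (ext σ x) ≡ ext τ x
  E1 ρ σ τ h here      = refl
  E1 ρ σ τ h (there x) =
    trans (ren-ren (extR ρ) there (σ x))
          (trans (sym (ren-ren there ρ (σ x))) (cong (ren there) (h x)))

  E1* : (P : Ctx) (ρ : Ren Γ Δ) (σ : Sub B Δ Θ) →
        ∀ {p} (x : P ++ Θ ∋ p) → ren (extR* P ρ) (ext* P σ x) ≡ ext* P (λ y → ren ρ (σ y)) x
  E1* []      ρ σ x = refl
  E1* (q ∷ P) ρ σ x = E1 (extR* P ρ) (ext* P σ) (ext* P (λ y → ren ρ (σ y))) (E1* P ρ σ) x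

  mutual
    ren-sub : .(i : C ⊆B B) (ρ : Ren Γ Δ) (σ : Sub B Δ Θ) (d : Der C Θ p) →
              ren ρ (sub i σ d) ≡ sub i (λ x → ren ρ (σ x)) d
    ren-sub i ρ σ (var x)      = refl
    ren-sub i ρ σ (app R m as) = cong (app R (i m)) (renA-subA i ρ σ as)

    renA-subA : .(i : C ⊆B B) (ρ : Ren Γ Δ) (σ : Sub B Δ Θ) (as : Args C Θ ps) →
                renA ρ (subA i σ as) ≡ subA i (λ x → ren ρ (σ x)) as
    renA-subA i ρ σ []             = refl
    renA-subA i ρ σ (_∷_ {P} d as) =
      cong₂ _∷_ (trans (ren-sub i (extR* P ρ) (ext* P σ) d)
                       (sub-cong i (E1* P ρ σ) d))
                (renA-subA i ρ σ as)

  E2* : (P : Ctx) (σ : Sub B Γ Δ) (ρ : Ren Δ Θ) →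
        ∀ {p} (x : P ++ Θ ∋ p) → ext* P σ (extR* P ρ x) ≡ ext* P (λ y → σ (ρ y)) x
  E2* []      σ ρ x         = refl
  E2* (q ∷ P) σ ρ here      = refl
  E2* (q ∷ P) σ ρ (there x) = cong (ren there) (E2* P σ ρ x)

  mutual
    sub-ren : .(i : C ⊆B B) (σ : Sub B Γ Δ) (ρ : Ren Δ Θ) (d : Der C Θ p) →
              sub i σ (ren ρ d) ≡ sub i (λ x → σ (ρ x)) d
    sub-ren i σ ρ (var x)      = refl
    sub-ren i σ ρ (app R m as) = cong (app R (i m)) (subA-renA i σ ρ as)

    subA-renA : .(i : C ⊆B B) (σ : Sub B Γ Δ) (ρ : Ren Δ Θ) (as : Args C Θ ps) →
                subA i σ (renA ρ as) ≡ subA i (λ x → σ (ρ x)) as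
    subA-renA i σ ρ []             = refl
    subA-renA i σ ρ (_∷_ {P} d as) =
      cong₂ _∷_ (trans (sub-ren i (ext* P σ) (extR* P ρ) d)
                       (sub-cong i (E2* P σ ρ) d))
                (subA-renA i σ ρ as)

  E3 : .(i : C ⊆B B) (τ : Sub B Γ Δ) (σ : Sub C Δ Θ) (υ : Sub B Γ Θ) →
       (∀ {p} (x : Θ ∋ p) → sub i τ (σ x) ≡ υ x) →
       ∀ {p} (x : q ∷ Θ ∋ p) → sub i (ext τ) (ext σ x) ≡ ext υ x
  E3 i τ σ υ h here      = refl
  E3 i τ σ υ h (there x) =
    trans (sub-ren i (ext τ) there (σ x))
          (trans (sym (ren-sub i there τ (σ x))) (cong (ren there) (h x)))

  E3* : (P : Ctx) .(i : C ⊆B B) (τ : Sub B Γ Δ) (σ : Sub C Δ Θ) →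
        ∀ {p} (x : P ++ Θ ∋ p) → sub i (ext* P τ) (ext* P σ x) ≡ ext* P (λ y → sub i τ (σ y)) x
  E3* []      i τ σ x = refl
  E3* (q ∷ P) i τ σ x = E3 i (ext* P τ) (ext* P σ) (ext* P (λ y → sub i τ (σ y))) (E3* P i τ σ) x

  mutual
    sub-sub : .(i : C ⊆B B) .(j : D ⊆B C) (τ : Sub B Γ Δ) (σ : Sub C Δ Θ) (d : Der D Θ p) →
              sub i τ (sub j σ d) ≡ sub (λ m → i (j m)) (λ x → sub i τ (σ x)) d
    sub-sub i j τ σ (var x)      = refl
    sub-sub i j τ σ (app R m as) = cong (app R (i (j m))) (subA-subA i j τ σ as)

    subA-subA : .(i : C ⊆B B) .(j : D ⊆B C) (τ : Sub B Γ Δ) (σ : Sub C Δ Θ) (as : Args D Θ ps) →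
                subA i τ (subA j σ as) ≡ subA (λ m → i (j m)) (λ x → sub i τ (σ x)) as
    subA-subA i j τ σ []             = refl
    subA-subA i j τ σ (_∷_ {P} d as) =
      cong₂ _∷_ (trans (sub-sub i j (ext* P τ) (ext* P σ) d)
                       (sub-cong (λ m → i (j m)) (E3* P i τ σ) d))
                (subA-subA i j τ σ as)

record World : Set₁ where
  constructor ⟨_,_⟩
  field
    base : Base
    ctx  : Ctx
open World public

lk : ∀ {ℓ} {P : Atom → Set ℓ} → All P Δ → Δ ∋ p → P p
lk (d ∷ t) here      = d
lk (d ∷ t) (there x) = lk t x

mapAll : ∀ {ℓ ℓ'} {P : Atom → Set ℓ} {Q : Atom → Set ℓ'} →
         (∀ {p} → P p → Q p) → All P Δ → All Q Δ
mapAll f []      = []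
mapAll f (d ∷ t) = f d ∷ mapAll f t

record Hom (w v : World) : Set₁ where
  constructor hom
  field
    .incl : base v ⊆B base w
    tup   : All (Der (base w) (ctx w)) (ctx v)
open Hom public

actD : ∀ {w v} → Hom w v → Der (base v) (ctx v) p → Der (base w) (ctx w) p
actD (hom i t) d = sub i (lk t) d

infixr 9 _∘W_
_∘W_ : ∀ {u w v} → Hom w v → Hom u w → Hom u v
hom j s ∘W hom i t = hom (λ m → i (j m)) (mapAll (actD (hom i t)) s)

private
  lk-map : ∀ {ℓ ℓ'} {P : Atom → Set ℓ} {Q : Atom → Set ℓ'} (f : ∀ {p} → P p → Q p)
           (t : All P Δ) (x : Δ ∋ p) → lk (mapAll f t) x ≡ f (lk t x)
  lk-map f (d ∷ t) here      = refl
  lk-map f (d ∷ t) (there x) = lk-map f t x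

  mapAll-cong : ∀ {ℓ ℓ'} {P : Atom → Set ℓ} {Q : Atom → Set ℓ'} {f g : ∀ {p} → P p → Q p} →
                (∀ {p} (x : P p) → f x ≡ g x) → (t : All P Δ) → mapAll f t ≡ mapAll g t
  mapAll-cong h []      = refl
  mapAll-cong h (d ∷ t) = cong₂ _∷_ (h d) (mapAll-cong h t)

  mapAll-comp : ∀ {ℓ ℓ' ℓ''} {P : Atom → Set ℓ} {Q : Atom → Set ℓ'} {S : Atom → Set ℓ''}
                (g : ∀ {p} → Q p → S p) (f : ∀ {p} → P p → Q p) (t : All P Δ) →
                mapAll g (mapAll f t) ≡ mapAll (λ x → g (f x)) t
  mapAll-comp g f []      = refl
  mapAll-comp g f (d ∷ t) = cong (g (f d) ∷_) (mapAll-comp g f t)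

  actD-∘ : ∀ {u w v} (g : Hom w v) (f : Hom u w) (d : Der (base v) (ctx v) p) →
           actD f (actD g d) ≡ actD (g ∘W f) d
  actD-∘ (hom j s) (hom i t) d =
    trans (sub-sub i j (lk t) (lk s) d)
          (sub-cong (λ m → i (j m)) (λ x → sym (lk-map (actD (hom i t)) s x)) d)

∘W-assoc : ∀ {a b c d} (h : Hom c d) (g : Hom b c) (f : Hom a b) →
           h ∘W (g ∘W f) ≡ (h ∘W g) ∘W f
∘W-assoc (hom k r) g f =
  cong (hom _) (sym (trans (mapAll-comp (actD f) (actD g) r)
                           (mapAll-cong (λ d → actD-∘ g f d) r)))

private
  allVars : (Γ : Ctx) → All (Γ ∋_) Γ
  allVars []      = []
  allVars (q ∷ Γ) = here ∷ mapAll there (allVars Γ)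

  lk-allVars : (x : Γ ∋ p) → lk (allVars Γ) x ≡ x
  lk-allVars here                = refl
  lk-allVars {Γ = q ∷ Γ} (there x) = trans (lk-map there (allVars Γ) x) (cong there (lk-allVars x))

  ext*-id : (P : Ctx) {σ : Sub B Γ Γ} → (∀ {p} (x : Γ ∋ p) → σ x ≡ var x) →
            ∀ {p} (x : P ++ Γ ∋ p) → ext* P σ x ≡ var x
  ext*-id []      h x         = h x
  ext*-id (q ∷ P) h here      = refl
  ext*-id (q ∷ P) h (there x) = cong (ren there) (ext*-id P h x)

  mutual
    sub-id : .(i : B ⊆B B) {σ : Sub B Γ Γ} → (∀ {p} (x : Γ ∋ p) → σ x ≡ var x) →
             (d : Der B Γ p) → sub i σ d ≡ d
    sub-id i h (var x)      = h x
    sub-id i h (app R m as) = cong (app R (i m)) (subA-id i h as)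

    subA-id : .(i : B ⊆B B) {σ : Sub B Γ Γ} → (∀ {p} (x : Γ ∋ p) → σ x ≡ var x) →
              (as : Args B Γ ps) → subA i σ as ≡ as
    subA-id i h []             = refl
    subA-id i h (_∷_ {P} d as) = cong₂ _∷_ (sub-id i (ext*-id P h) d) (subA-id i h as)

  mapAll-id : ∀ {ℓ} {P : Atom → Set ℓ} {f : ∀ {p} → P p → P p} →
              (∀ {p} (x : P p) → f x ≡ x) → (t : All P Δ) → mapAll f t ≡ t
  mapAll-id h []      = []≡
    where []≡ = refl
  mapAll-id h (d ∷ t) = cong₂ _∷_ (h d) (mapAll-id h t)

  tup-lk-vars : ∀ {ℓ} {P : Atom → Set ℓ} (t : All P Γ) → mapAll (λ x → lk t x) (allVars Γ) ≡ t
  tup-lk-vars []      = refl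
  tup-lk-vars (d ∷ t) = cong (d ∷_) (trans (mapAll-comp (lk (d ∷ t)) there (allVars _)) (tup-lk-vars t))

idW : ∀ {w} → Hom w w
idW {w} = hom (λ m → m) (mapAll var (allVars (ctx w)))

private
  lk-idW : ∀ {w} (x : ctx w ∋ p) → lk (tup (idW {w})) x ≡ var x
  lk-idW {w = w} x = trans (lk-map var (allVars (ctx w)) x) (cong var (lk-allVars x))

actD-id : ∀ {w} (d : Der (base w) (ctx w) p) → actD (idW {w}) d ≡ d
actD-id d = sub-id (λ m → m) lk-idW d

actD-∘W : ∀ {u w v} (g : Hom w v) (f : Hom u w) (d : Der (base v) (ctx v) p) →
          actD (g ∘W f) d ≡ actD f (actD g d)
actD-∘W g f d = sym (actD-∘ g f d)

∘W-idˡ : ∀ {w v} (f : Hom w v) → idW ∘W f ≡ f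
∘W-idˡ {v = v} (hom i t) =
  cong (hom _) (trans (mapAll-comp (actD (hom i t)) var (allVars (ctx v))) (tup-lk-vars t))

∘W-idʳ : ∀ {w v} (f : Hom w v) → f ∘W idW ≡ f
∘W-idʳ (hom i t) = cong (hom _) (mapAll-id actD-id t)

-- Presheaves on 𝒲 (setoid-valued; constructively, the sets F(w) carry
-- their equality), natural transformations, products, exponentials

record Presheaf : Set₂ where
  field
    obj      : World → Setoid (lsuc 0ℓ) (lsuc 0ℓ)
    act      : ∀ {w v} → Hom w v → Setoid.Carrier (obj v) → Setoid.Carrier (obj w)
    act-cong : ∀ {w v} (f : Hom w v) {x y : Setoid.Carrier (obj v)} →
               Setoid._≈_ (obj v) x y → Setoid._≈_ (obj w) (act f x) (act f y)
    act-id   : ∀ {w} (x : Setoid.Carrier (obj w)) → Setoid._≈_ (obj w) (act (idW {w}) x) x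
    act-∘    : ∀ {u w v} (g : Hom w v) (f : Hom u w) (x : Setoid.Carrier (obj v)) →
               Setoid._≈_ (obj u) (act (g ∘W f) x) (act f (act g x))

  ∣_∣ : World → Set₁
  ∣ w ∣ = Setoid.Carrier (obj w)
open Presheaf public

infix 3 _⇒_
record _⇒_ (F G : Presheaf) : Set₁ where
  field
    η       : ∀ w → ∣ F ∣ w → ∣ G ∣ w
    η-cong  : ∀ w {x y : ∣ F ∣ w} → Setoid._≈_ (obj F w) x y →
              Setoid._≈_ (obj G w) (η w x) (η w y)
    natural : ∀ {w v} (f : Hom w v) (x : ∣ F ∣ v) →
              Setoid._≈_ (obj G w) (η w (act F f x)) (act G f (η v x))
open _⇒_ public

Yo : World → Presheaf
Yo v = record
  { obj      = λ w → PE.setoid (Hom w v)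
  ; act      = λ f g → g ∘W f
  ; act-cong = λ f eq → cong (_∘W f) eq
  ; act-id   = ∘W-idʳ
  ; act-∘    = λ g f h → ∘W-assoc h g f
  }

⊤P : Presheaf
⊤P = record
  { obj      = λ w → PE.setoid ⊤
  ; act      = λ f x → x
  ; act-cong = λ f eq → eq
  ; act-id   = λ x → refl
  ; act-∘    = λ g f x → refl
  }

infixr 6 _×P_
_×P_ : Presheaf → Presheaf → Presheaf
F ×P G = record
  { obj      = λ w → ×-setoid (obj F w) (obj G w)
  ; act      = λ f x → act F f (proj₁ x) , act G f (proj₂ x)
  ; act-cong = λ f eq → act-cong F f (proj₁ eq) , act-cong G f (proj₂ eq)
  ; act-id   = λ x → act-id F (proj₁ x) , act-id G (proj₂ x)
  ; act-∘    = λ g f x → act-∘ F g f (proj₁ x) , act-∘ G g f (proj₂ x)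
  }

ΠP : (Atom → Presheaf) → Presheaf
ΠP F = record
  { obj      = λ w → record
      { Carrier       = (p : Atom) → ∣ F p ∣ w
      ; _≈_           = λ x y → (p : Atom) → Setoid._≈_ (obj (F p) w) (x p) (y p)
      ; isEquivalence = record
          { refl  = λ p → Setoid.refl (obj (F p) w)
          ; sym   = λ e p → Setoid.sym (obj (F p) w) (e p)
          ; trans = λ e e' p → Setoid.trans (obj (F p) w) (e p) (e' p)
          }
      }
  ; act      = λ f x p → act (F p) f (x p)
  ; act-cong = λ f eq p → act-cong (F p) f (eq p)
  ; act-id   = λ x p → act-id (F p) (x p)
  ; act-∘    = λ g f x p → act-∘ (F p) g f (x p)
  }

infixr 4 _⊃P_
_⊃P_ : Presheaf → Presheaf → Presheaf
F ⊃P G = record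
  { obj      = λ w → record
      { Carrier       = (Yo w ×P F) ⇒ G
      ; _≈_           = λ θ θ' → ∀ v (a : ∣ Yo w ×P F ∣ v) →
                          Setoid._≈_ (obj G v) (η θ v a) (η θ' v a)
      ; isEquivalence = record
          { refl  = λ v a → Setoid.refl (obj G v)
          ; sym   = λ e v a → Setoid.sym (obj G v) (e v a)
          ; trans = λ e e' v a → Setoid.trans (obj G v) (e v a) (e' v a)
          }
      }
  ; act      = λ f θ → record
      { η       = λ v a → η θ v (f ∘W proj₁ a , proj₂ a)
      ; η-cong  = λ v {a} {b} e → η-cong θ v (cong (f ∘W_) (proj₁ e) , proj₂ e)
      ; natural = λ {v} {v'} h a →
          Setoid.trans (obj G v)
            (η-cong θ v (∘W-assoc f (proj₁ a) h , Setoid.refl (obj F v)))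
            (natural θ h (f ∘W proj₁ a , proj₂ a))
      }
  ; act-cong = λ f e v a → e v (f ∘W proj₁ a , proj₂ a)
  ; act-id   = λ θ v a → η-cong θ v (∘W-idˡ (proj₁ a) , Setoid.refl (obj F v))
  ; act-∘    = λ g f θ v a → η-cong θ v (sym (∘W-assoc g f (proj₁ a)) , Setoid.refl (obj F v))
  }

atomP : Atom → Presheaf
atomP p = record
  { obj      = λ w → PE.setoid (Der (base w) (ctx w) p)
  ; act      = actD
  ; act-cong = λ f eq → cong (actD f) eq
  ; act-id   = actD-id
  ; act-∘    = actD-∘W
  }

⟦_⟧ : Form → Presheaf
⟦ atom p ⟧  = atomP p
⟦ ⊥' ⟧      = ΠP atomP
⟦ φ ∧' ψ ⟧  = ⟦ φ ⟧ ×P ⟦ ψ ⟧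
⟦ φ ⊃' ψ ⟧  = ⟦ φ ⟧ ⊃P ⟦ ψ ⟧
⟦ φ ∨' ψ ⟧  = ΠP (λ p → (⟦ φ ⟧ ⊃P atomP p) ⊃P ((⟦ ψ ⟧ ⊃P atomP p) ⊃P atomP p))

⟦_⟧c : List Form → Presheaf
⟦ [] ⟧c    = ⊤P
⟦ φ ∷ Γ ⟧c = ⟦ φ ⟧ ×P ⟦ Γ ⟧c

infix 2 _⊨_
_⊨_ : List Form → Form → Set₁
Γ ⊨ φ = ⟦ Γ ⟧c ⇒ ⟦ φ ⟧

-- Completeness by normalisation by evaluation in a simulation base.  All of Γ and φ are
-- subformulae of ψ = γ₁ ∧ (γ₂ ∧ … ∧ φ); code them by atoms, an atom occurring in ψ by
-- itself and every other subformula by a fresh atom, and let 𝒩 be the base whose rules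
-- are the NJ inferences read through this code.  At every world whose base contains 𝒩,
-- induction on χ gives maps reify : ⟦χ⟧ → ⟦code χ⟧ and reflect : ⟦code χ⟧ → ⟦χ⟧, natural
-- in the world: an implication is reified by applying it to the reflection of a fresh
-- hypothesis, and a disjunction, whose interpretation is its own elimination rule, by
-- eliminating into code (α ∨ β) with the two injections.  Feeding the reflected
-- hypotheses at (𝒩, code Γ) to a natural transformation ⟦Γ⟧ → ⟦φ⟧ and reifying yields a
-- derivation in 𝒩, which becomes an NJ derivation because every rule of 𝒩 is an NJ
-- inference.

module Submission where

open import Defs
open import Data.Nat as ℕ using (ℕ; zero; suc; _+_; _∸_; _<_; _≤_; _<?_)
import Data.Nat.Properties as ℕ
open import Data.List using (List; []; _∷_; _++_; map; foldr)
open import Data.List.Properties using (map-++)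
open import Data.List.Membership.Propositional using (_∈_)
open import Data.List.Membership.Propositional.Properties using (∈-++⁺ˡ; ∈-++⁺ʳ)
open import Data.List.Relation.Binary.Subset.Propositional using (_⊆_)
open import Data.List.Relation.Unary.All using (All; []; _∷_)
open import Data.List.Relation.Unary.Any using (here; there; tail)
open import Data.Product using (_×_; _,_; uncurry)
open import Data.Sum using (_⊎_; inj₁; inj₂)
open import Data.Empty using (⊥)
open import Data.Unit.Polymorphic using (tt)
open import Data.Irrelevant using (Irrelevant; [_])
open import Relation.Binary.Bundles using (Setoid)
open import Relation.Binary.Definitions using (DecidableEquality)
open import Relation.Nullary using (Dec; yes; no; contradiction)
open import Relation.Nullary.Decidable using (map′; _×-dec_; _⊎-dec_; recompute)
open import Relation.Binary.PropositionalEquality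
  using (_≡_; refl; sym; trans; cong; cong₂; subst; subst₂; module ≡-Reasoning)

variable
  α β γ δ χ : Form
  u v w : World

∧-injective : α ∧' β ≡ γ ∧' δ → α ≡ γ × β ≡ δ
∧-injective refl = refl , refl

∨-injective : α ∨' β ≡ γ ∨' δ → α ≡ γ × β ≡ δ
∨-injective refl = refl , refl

⊃-injective : (α ⊃' β) ≡ (γ ⊃' δ) → α ≡ γ × β ≡ δ
⊃-injective refl = refl , refl

atom-injective : atom p ≡ atom q → p ≡ q
atom-injective refl = refl

infix 4 _≟ᶠ_
_≟ᶠ_ : DecidableEquality Form
atom p   ≟ᶠ atom q   = map′ (cong atom) atom-injective (p ℕ.≟ q)
⊥'       ≟ᶠ ⊥'       = yes refl
(α ∧' β) ≟ᶠ (γ ∧' δ) = map′ (uncurry (cong₂ _∧'_)) ∧-injective (α ≟ᶠ γ ×-dec β ≟ᶠ δ)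
(α ∨' β) ≟ᶠ (γ ∨' δ) = map′ (uncurry (cong₂ _∨'_)) ∨-injective (α ≟ᶠ γ ×-dec β ≟ᶠ δ)
(α ⊃' β) ≟ᶠ (γ ⊃' δ) = map′ (uncurry (cong₂ _⊃'_)) ⊃-injective (α ≟ᶠ γ ×-dec β ≟ᶠ δ)
atom _   ≟ᶠ ⊥'       = no λ ()
atom _   ≟ᶠ (_ ∧' _) = no λ ()
atom _   ≟ᶠ (_ ∨' _) = no λ ()
atom _   ≟ᶠ (_ ⊃' _) = no λ ()
⊥'       ≟ᶠ atom _   = no λ ()
⊥'       ≟ᶠ (_ ∧' _) = no λ ()
⊥'       ≟ᶠ (_ ∨' _) = no λ ()
⊥'       ≟ᶠ (_ ⊃' _) = no λ ()
(_ ∧' _) ≟ᶠ atom _   = no λ ()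
(_ ∧' _) ≟ᶠ ⊥'       = no λ ()
(_ ∧' _) ≟ᶠ (_ ∨' _) = no λ ()
(_ ∧' _) ≟ᶠ (_ ⊃' _) = no λ ()
(_ ∨' _) ≟ᶠ atom _   = no λ ()
(_ ∨' _) ≟ᶠ ⊥'       = no λ ()
(_ ∨' _) ≟ᶠ (_ ∧' _) = no λ ()
(_ ∨' _) ≟ᶠ (_ ⊃' _) = no λ ()
(_ ⊃' _) ≟ᶠ atom _   = no λ ()
(_ ⊃' _) ≟ᶠ ⊥'       = no λ ()
(_ ⊃' _) ≟ᶠ (_ ∧' _) = no λ ()
(_ ⊃' _) ≟ᶠ (_ ∨' _) = no λ ()

data Conjunct : Form → Form → Set where
  left  : Conjunct α (α ∧' β)
  right : Conjunct β (α ∧' β)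

data Disjunct : Form → Form → Set where
  left  : Disjunct α (α ∨' β)
  right : Disjunct β (α ∨' β)

conjunct? : ∀ γ δ → Dec (Conjunct γ δ)
conjunct? γ (α ∧' β) with γ ≟ᶠ α | γ ≟ᶠ β
... | yes refl | _        = yes left
... | no _     | yes refl = yes right
... | no γ≢α   | no γ≢β   = no λ { left → γ≢α refl ; right → γ≢β refl }
conjunct? γ (atom _) = no λ ()
conjunct? γ ⊥'       = no λ ()
conjunct? γ (_ ∨' _) = no λ ()
conjunct? γ (_ ⊃' _) = no λ ()

disjunct? : ∀ γ δ → Dec (Disjunct γ δ)
disjunct? γ (α ∨' β) with γ ≟ᶠ α | γ ≟ᶠ β
... | yes refl | _        = yes left
... | no _     | yes refl = yes right
... | no γ≢α   | no γ≢β   = no λ { left → γ≢α refl ; right → γ≢β refl }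
disjunct? γ (atom _) = no λ ()
disjunct? γ ⊥'       = no λ ()
disjunct? γ (_ ∧' _) = no λ ()
disjunct? γ (_ ⊃' _) = no λ ()

conjunct-elim : {Θ : List Form} → Conjunct γ δ → Θ ⊢ δ → Θ ⊢ γ
conjunct-elim left  = ∧E₁
conjunct-elim right = ∧E₂

disjunct-intro : {Θ : List Form} → Disjunct γ δ → Θ ⊢ γ → Θ ⊢ δ
disjunct-intro left  = ∨I₁
disjunct-intro right = ∨I₂

_≗ˢ_ : Sub B Γ Δ → Sub B Γ Δ → Set₁
_≗ˢ_ {Δ = Δ} σ τ = ∀ {p} (x : Δ ∋ p) → σ x ≡ τ x

ext*-cong : (P : Ctx) {σ τ : Sub B Γ Δ} → σ ≗ˢ τ → ext* P σ ≗ˢ ext* P τ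
ext*-cong []      σ≗τ x         = σ≗τ x
ext*-cong (q ∷ P) σ≗τ here      = refl
ext*-cong (q ∷ P) σ≗τ (there x) = cong (ren there) (ext*-cong P σ≗τ x)

mutual
  sub-cong : .(i : C ⊆B B) {σ τ : Sub B Γ Δ} → σ ≗ˢ τ → (d : Der C Δ p) → sub i σ d ≡ sub i τ d
  sub-cong i σ≗τ (var x)      = σ≗τ x
  sub-cong i σ≗τ (app R m as) = cong (app R (i m)) (subA-cong i σ≗τ as)

  subA-cong : .(i : C ⊆B B) {σ τ : Sub B Γ Δ} → σ ≗ˢ τ → (as : Args C Δ ps) → subA i σ as ≡ subA i τ as
  subA-cong i σ≗τ []             = refl
  subA-cong i σ≗τ (_∷_ {P} d as) = cong₂ _∷_ (sub-cong i (ext*-cong P σ≗τ) d) (subA-cong i σ≗τ as)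

ext*-var : (P : Ctx) (ρ : Ren Γ Δ) → ext* {B = B} P (λ x → var (ρ x)) ≗ˢ (λ x → var (extR* P ρ x))
ext*-var []      ρ x         = refl
ext*-var (q ∷ P) ρ here      = refl
ext*-var (q ∷ P) ρ (there x) = cong (ren there) (ext*-var P ρ x)

mutual
  sub-var : .(i : B ⊆B B) (ρ : Ren Γ Δ) (d : Der B Δ p) → sub i (λ x → var (ρ x)) d ≡ ren ρ d
  sub-var i ρ (var x)      = refl
  sub-var i ρ (app R m as) = cong (app R (i m)) (subA-var i ρ as)

  subA-var : .(i : B ⊆B B) (ρ : Ren Γ Δ) (as : Args B Δ ps) → subA i (λ x → var (ρ x)) as ≡ renA ρ as
  subA-var i ρ []             = refl
  subA-var i ρ (_∷_ {P} d as) =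
    cong₂ _∷_ (trans (sub-cong i (ext*-var P ρ) d) (sub-var i (extR* P ρ) d)) (subA-var i ρ as)

tabulate : ∀ {ℓ} {P : Atom → Set ℓ} → (∀ {p} → Δ ∋ p → P p) → All P Δ
tabulate {Δ = []}    f = []
tabulate {Δ = q ∷ Δ} f = f here ∷ tabulate (λ x → f (there x))

lk-tabulate : ∀ {ℓ} {P : Atom → Set ℓ} (f : ∀ {p} → Δ ∋ p → P p) (x : Δ ∋ p) → lk (tabulate f) x ≡ f x
lk-tabulate f here      = refl
lk-tabulate f (there x) = lk-tabulate (λ y → f (there y)) x

lk-mapAll : ∀ {ℓ ℓ′} {P : Atom → Set ℓ} {Q : Atom → Set ℓ′} (f : ∀ {p} → P p → Q p)
            (t : All P Δ) (x : Δ ∋ p) → lk (mapAll f t) x ≡ f (lk t x)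
lk-mapAll f (d ∷ t) here      = refl
lk-mapAll f (d ∷ t) (there x) = lk-mapAll f t x

lk-injective : ∀ {ℓ} {P : Atom → Set ℓ} (t s : All P Δ) → (∀ {p} (x : Δ ∋ p) → lk t x ≡ lk s x) → t ≡ s
lk-injective []      []      t≗s = refl
lk-injective (d ∷ t) (e ∷ s) t≗s = cong₂ _∷_ (t≗s here) (lk-injective t s (λ x → t≗s (there x)))

infixl 5 _▷_
_▷_ : World → Atom → World
w ▷ q = ⟨ base w , q ∷ ctx w ⟩

shift : All (Der B (q ∷ Δ)) Δ
shift = tabulate (λ x → var (there x))

weaken : Hom (w ▷ q) w
weaken = hom (λ m → m) shift

lift : Hom u w → Hom (u ▷ q) (w ▷ q)
lift (hom i t) = hom i (tabulate (ext (lk t)))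

actD-lift : .(i : base w ⊆B base u) (t : All (Der (base u) (ctx u)) (ctx w)) (d : Der (base w) (q ∷ ctx w) p) →
            actD (lift (hom i t)) d ≡ sub i (ext (lk t)) d
actD-lift i t = sub-cong i (lk-tabulate (ext (lk t)))

weaken-lift : (h : Hom u w) → weaken {q = q} ∘W lift h ≡ h ∘W weaken
weaken-lift (hom i t) = cong (hom i) (lk-injective _ _ λ x → begin
  lk (mapAll (actD (lift h)) shift) x            ≡⟨ lk-mapAll (actD (lift h)) shift x ⟩
  actD (lift h) (lk shift x)                     ≡⟨ cong (actD (lift h)) (lk-tabulate _ x) ⟩
  lk (tabulate (ext (lk t))) (there x)           ≡⟨ lk-tabulate (ext (lk t)) (there x) ⟩
  ren there (lk t x)                             ≡⟨ sym (sub-var (λ m → m) there (lk t x)) ⟩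
  sub (λ m → m) (λ y → var (there y)) (lk t x)  ≡⟨ sym (sub-cong (λ m → m) (lk-tabulate _) (lk t x)) ⟩
  actD weaken (lk t x)                           ≡⟨ sym (lk-mapAll (actD weaken) t x) ⟩
  lk (mapAll (actD weaken) t) x                  ∎)
  where
    open ≡-Reasoning
    h = hom i t

data Shape : List (Ctx × Atom) → Set where
  single      : ∀ x → Shape (([] , x) ∷ [])
  discharging : ∀ x y → Shape ((x ∷ [] , y) ∷ [])
  pair        : ∀ x y → Shape (([] , x) ∷ ([] , y) ∷ [])
  cases       : ∀ d x r y s → Shape (([] , d) ∷ (x ∷ [] , r) ∷ (y ∷ [] , s) ∷ [])
  other       : Shape ps

shape : ∀ ps → Shape ps
shape (([] , x) ∷ [])                                 = single x
shape ((x ∷ [] , y) ∷ [])                             = discharging x y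
shape (([] , x) ∷ ([] , y) ∷ [])                      = pair x y
shape (([] , d) ∷ (x ∷ [] , r) ∷ (y ∷ [] , s) ∷ []) = cases d x r y s
shape _                                               = other

module Simulation (decode : Atom → Form) where

  Inference : Shape ps → Atom → Set
  Inference (single x)          z = Conjunct (decode z) (decode x) ⊎ Disjunct (decode x) (decode z) ⊎ decode x ≡ ⊥'
  Inference (discharging x y)   z = decode z ≡ (decode x ⊃' decode y)
  Inference (pair x y)          z = decode z ≡ decode x ∧' decode y ⊎ decode x ≡ (decode y ⊃' decode z)
  Inference (cases d x r y s)   z = decode d ≡ decode x ∨' decode y × r ≡ z × s ≡ z
  Inference other               z = ⊥

  inference? : (sh : Shape ps) (z : Atom) → Dec (Inference sh z)
  inference? (single x)        z = conjunct? _ _ ⊎-dec disjunct? _ _ ⊎-dec decode x ≟ᶠ ⊥'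
  inference? (discharging x y) z = decode z ≟ᶠ _
  inference? (pair x y)        z = decode z ≟ᶠ _ ⊎-dec decode x ≟ᶠ _
  inference? (cases d x r y s) z = decode d ≟ᶠ _ ×-dec r ℕ.≟ z ×-dec s ℕ.≟ z
  inference? other             z = no λ ()

  -- Base membership is irrelevant in derivations, so translate must recompute it;
  -- this is why 𝒩 is given by decidable conditions.
  𝒩 : Base
  𝒩 (rule ps z) = Inference (shape ps) z

  Premise : List Form → Ctx × Atom → Set
  Premise Θ (P , q) = map decode P ++ Θ ⊢ decode q

  infer : {Θ : List Form} {z : Atom} (sh : Shape ps) → Inference sh z → All (Premise Θ) ps → Θ ⊢ decode z
  infer (single x)        (inj₁ c)        (d ∷ [])              = conjunct-elim c d
  infer (single x)        (inj₂ (inj₁ c)) (d ∷ [])              = disjunct-intro c d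
  infer (single x)        (inj₂ (inj₂ e)) (d ∷ [])              = ⊥E (subst (_ ⊢_) e d)
  infer (discharging x y) e               (d ∷ [])              = subst (_ ⊢_) (sym e) (⊃I d)
  infer (pair x y)        (inj₁ e)        (d₁ ∷ d₂ ∷ [])        = subst (_ ⊢_) (sym e) (∧I d₁ d₂)
  infer (pair x y)        (inj₂ e)        (d₁ ∷ d₂ ∷ [])        = ⊃E (subst (_ ⊢_) e d₁) d₂
  infer (cases d x r y s) (e , refl , refl) (d₀ ∷ d₁ ∷ d₂ ∷ []) = ∨E (subst (_ ⊢_) e d₀) d₁ d₂

  decode-∋ : Δ ∋ q → decode q ∈ map decode Δ
  decode-∋ here      = here refl
  decode-∋ (there x) = there (decode-∋ x)

  mutual
    translate : Der 𝒩 Δ q → map decode Δ ⊢ decode q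
    translate (var x)                = ax (decode-∋ x)
    translate (app (rule ps z) m as) = infer (shape ps) (recompute (inference? (shape ps) z) m) (translate-args as)

    translate-args : Args 𝒩 Δ ps → All (Premise (map decode Δ)) ps
    translate-args []                 = []
    translate-args {Δ} (_∷_ {P} d as) = subst (_⊢ _) (map-++ decode P Δ) (translate d) ∷ translate-args as

  -- A record rather than an irrelevant argument, so that restrict can be defined.
  Over : World → Set
  Over w = Irrelevant (𝒩 ⊆B base w)

  restrict : Hom u w → Over w → Over u
  restrict (hom i t) [ o ] = [ (λ m → i (o m)) ]

  Derivation : World → Atom → Set₁
  Derivation w = Der (base w) (ctx w)

  by : Over w → (R : Rule) → 𝒩 R → Args (base w) (ctx w) (prem R) → Derivation w (concl R)
  by [ o ] R m as = app R (o m) as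

  by-single : ∀ {x z} → Over w → Inference (single x) z → Derivation w x → Derivation w z
  by-single {x = x} {z} o m d = by o (rule (([] , x) ∷ []) z) m (d ∷ [])

  by-discharging : ∀ {x y z} → Over w → Inference (discharging x y) z → Derivation (w ▷ x) y → Derivation w z
  by-discharging {x = x} {y} {z} o m d = by o (rule ((x ∷ [] , y) ∷ []) z) m (d ∷ [])

  by-pair : ∀ {x y z} → Over w → Inference (pair x y) z → Derivation w x → Derivation w y → Derivation w z
  by-pair {x = x} {y} {z} o m d₁ d₂ = by o (rule (([] , x) ∷ ([] , y) ∷ []) z) m (d₁ ∷ d₂ ∷ [])

  by-cases : ∀ {d x y z} → Over w → Inference (cases d x z y z) z →
             Derivation w d → Derivation (w ▷ x) z → Derivation (w ▷ y) z → Derivation w z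
  by-cases {d = d} {x} {y} {z} o m d₀ d₁ d₂ =
    by o (rule (([] , d) ∷ (x ∷ [] , z) ∷ (y ∷ [] , z) ∷ []) z) m (d₀ ∷ d₁ ∷ d₂ ∷ [])

  Eq : (F : Presheaf) (w : World) → ∣ F ∣ w → ∣ F ∣ w → Set₁
  Eq F w = Setoid._≈_ (obj F w)

  -- A natural transformation H × F → G on the worlds over 𝒩; Λ is its transpose.
  record Operation (H F G : Presheaf) : Set₁ where
    field
      run         : Over w → ∣ H ∣ w → ∣ F ∣ w → ∣ G ∣ w
      run-cong    : (o : Over w) {e e′ : ∣ H ∣ w} {x y : ∣ F ∣ w} →
                    Eq H w e e′ → Eq F w x y → Eq G w (run o e x) (run o e′ y)
      run-natural : (o : Over w) (h : Hom u w) (e : ∣ H ∣ w) (x : ∣ F ∣ w) →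
                    Eq G u (run (restrict h o) (act H h e) (act F h x)) (act G h (run o e x))
  open Operation

  module _ {H F G : Presheaf} (op : Operation H F G) where

    Λ : Over w → ∣ H ∣ w → ∣ F ⊃P G ∣ w
    Λ o e = record
      { η       = λ _ (f , x) → run op (restrict f o) (act H f e) x
      ; η-cong  = λ { _ {f , _} (refl , x≈y) → run-cong op (restrict f o) (Setoid.refl (obj H _)) x≈y }
      ; natural = λ h (f , x) → Setoid.trans (obj G _)
                    (run-cong op _ (act-∘ H f h e) (Setoid.refl (obj F _)))
                    (run-natural op (restrict f o) h (act H f e) x)
      }

    Λ-cong : (o : Over w) {e e′ : ∣ H ∣ w} → Eq H w e e′ → Eq (F ⊃P G) w (Λ o e) (Λ o e′)
    Λ-cong o e≈e′ _ (f , x) = run-cong op (restrict f o) (act-cong H f e≈e′) (Setoid.refl (obj F _))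

    Λ-natural : (o : Over w) (h : Hom u w) (e : ∣ H ∣ w) →
                Eq (F ⊃P G) u (Λ (restrict h o) (act H h e)) (act (F ⊃P G) h (Λ o e))
    Λ-natural o h e _ (f , x) = run-cong op _ (Setoid.sym (obj H _) (act-∘ H h f e)) (Setoid.refl (obj F _))

module Reification (decode : Atom → Form) (label : Form → Atom) where
  open Simulation decode

  -- Atoms must code themselves, since ⟦ atom p ⟧ consists of derivations of p.
  code : Form → Atom
  code (atom p) = p
  code χ        = label χ

  Coded : Form → Set
  Coded (atom p) = decode p ≡ atom p
  Coded ⊥'       = decode (code ⊥') ≡ ⊥'
  Coded (α ∧' β) = decode (code (α ∧' β)) ≡ decode (code α) ∧' decode (code β) × Coded α × Coded β
  Coded (α ∨' β) = decode (code (α ∨' β)) ≡ decode (code α) ∨' decode (code β) × Coded α × Coded β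
  Coded (α ⊃' β) = decode (code (α ⊃' β)) ≡ (decode (code α) ⊃' decode (code β)) × Coded α × Coded β

  decode-code : ∀ χ → Coded χ → decode (code χ) ≡ χ
  decode-code (atom p) c            = c
  decode-code ⊥'       c            = c
  decode-code (α ∧' β) (e , cα , cβ) = trans e (cong₂ _∧'_ (decode-code α cα) (decode-code β cβ))
  decode-code (α ∨' β) (e , cα , cβ) = trans e (cong₂ _∨'_ (decode-code α cα) (decode-code β cβ))
  decode-code (α ⊃' β) (e , cα , cβ) = trans e (cong₂ _⊃'_ (decode-code α cα) (decode-code β cβ))

  ∧-intro : Over w → Coded (α ∧' β) →
            Derivation w (code α) → Derivation w (code β) → Derivation w (code (α ∧' β))
  ∧-intro o (e , _) d₁ d₂ = by-pair o (inj₁ e) d₁ d₂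

  ∧-elimˡ : Over w → Coded (α ∧' β) → Derivation w (code (α ∧' β)) → Derivation w (code α)
  ∧-elimˡ o (e , _) d = by-single o (inj₁ (subst (Conjunct _) (sym e) left)) d

  ∧-elimʳ : Over w → Coded (α ∧' β) → Derivation w (code (α ∧' β)) → Derivation w (code β)
  ∧-elimʳ o (e , _) d = by-single o (inj₁ (subst (Conjunct _) (sym e) right)) d

  ∨-introˡ : Over w → Coded (α ∨' β) → Derivation w (code α) → Derivation w (code (α ∨' β))
  ∨-introˡ o (e , _) d = by-single o (inj₂ (inj₁ (subst (Disjunct _) (sym e) left))) d

  ∨-introʳ : Over w → Coded (α ∨' β) → Derivation w (code β) → Derivation w (code (α ∨' β))
  ∨-introʳ o (e , _) d = by-single o (inj₂ (inj₁ (subst (Disjunct _) (sym e) right))) d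

  ∨-elim : Over w → Coded (α ∨' β) → Derivation w (code (α ∨' β)) →
           Derivation (w ▷ code α) p → Derivation (w ▷ code β) p → Derivation w p
  ∨-elim o (e , _) d d₁ d₂ = by-cases o (e , refl , refl) d d₁ d₂

  ⊃-intro : Over w → Coded (α ⊃' β) → Derivation (w ▷ code α) (code β) → Derivation w (code (α ⊃' β))
  ⊃-intro o (e , _) d = by-discharging o e d

  ⊃-elim : Over w → Coded (α ⊃' β) →
           Derivation w (code (α ⊃' β)) → Derivation w (code α) → Derivation w (code β)
  ⊃-elim o (e , _) d₁ d₂ = by-pair o (inj₂ e) d₁ d₂

  ex-falso : Over w → Coded ⊥' → Derivation w (code ⊥') → Derivation w p
  ex-falso o e d = by-single o (inj₂ (inj₂ e)) d

  ⊃-intro-natural : (o : Over w) (c : Coded (α ⊃' β)) (h : Hom u w) (d : Derivation (w ▷ code α) (code β)) →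
                    actD h (⊃-intro o c d) ≡ ⊃-intro (restrict h o) c (actD (lift h) d)
  ⊃-intro-natural o c (hom i t) d = cong (⊃-intro (restrict (hom i t) o) c) (sym (actD-lift i t d))

  ∨-elim-natural : (o : Over w) (c : Coded (α ∨' β)) (h : Hom u w) (d : Derivation w (code (α ∨' β)))
                   (d₁ : Derivation (w ▷ code α) p) (d₂ : Derivation (w ▷ code β) p) →
                   actD h (∨-elim o c d d₁ d₂) ≡
                   ∨-elim (restrict h o) c (actD h d) (actD (lift h) d₁) (actD (lift h) d₂)
  ∨-elim-natural o c (hom i t) d d₁ d₂ =
    cong₂ (∨-elim (restrict (hom i t) o) c (actD (hom i t) d)) (sym (actD-lift i t d₁)) (sym (actD-lift i t d₂))

  El : Form → World → Set₁
  El χ w = ∣ ⟦ χ ⟧ ∣ w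

  mutual
    reify : ∀ χ → Coded χ → Over w → El χ w → Derivation w (code χ)
    reify (atom p) c                o x       = x
    reify ⊥'       c                o x       = x (code ⊥')
    reify (α ∧' β) c@(_ , cα , cβ) o (x , y) = ∧-intro o c (reify α cα o x) (reify β cβ o y)
    reify (α ⊃' β) c@(_ , cα , cβ) o θ       = ⊃-intro o c (reify β cβ o (apply-fresh α cα o ⟦ β ⟧ θ))
    reify (α ∨' β) c                o x       =
      η (η (x (code (α ∨' β))) _ (idW , injectionˡ c o)) _ (idW , injectionʳ c o)

    reflect : ∀ χ → Coded χ → Over w → Derivation w (code χ) → El χ w
    reflect (atom p) c                o d = d
    reflect ⊥'       c                o d = λ p → ex-falso o c d
    reflect (α ∧' β) c@(_ , cα , cβ) o d = reflect α cα o (∧-elimˡ o c d) , reflect β cβ o (∧-elimʳ o c d)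
    reflect (α ⊃' β) c                o d = Λ (⊃-application c) o d
    reflect (α ∨' β) c                o d = λ p → Λ (∨-continuation c p) o d

    apply-fresh : ∀ α → Coded α → Over w → (F : Presheaf) → ∣ ⟦ α ⟧ ⊃P F ∣ w → ∣ F ∣ (w ▷ code α)
    apply-fresh α c o F θ = η θ _ (weaken , reflect α c o (var here))

    reify-then : ∀ α → Coded α → (r : ∀ {v} → Over v → Derivation v (code α) → Derivation v q) →
                 (∀ {v u} (o : Over v) (h : Hom u v) d → r (restrict h o) (actD h d) ≡ actD h (r o d)) →
                 Operation ⊤P ⟦ α ⟧ (atomP q)
    reify-then α c r r-natural = record
      { run         = λ o _ x → r o (reify α c o x)
      ; run-cong    = λ o _ x≈y → cong (r o) (reify-cong α c o x≈y)
      ; run-natural = λ o h _ x → trans (cong (r (restrict h o)) (reify-natural α c o h x)) (r-natural o h _)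
      }

    injectionˡ : Coded (α ∨' β) → Over w → ∣ ⟦ α ⟧ ⊃P atomP (code (α ∨' β)) ∣ w
    injectionˡ {α} c@(_ , cα , _) o = Λ (reify-then α cα (λ o′ → ∨-introˡ o′ c) (λ _ _ _ → refl)) o tt

    injectionʳ : Coded (α ∨' β) → Over w → ∣ ⟦ β ⟧ ⊃P atomP (code (α ∨' β)) ∣ w
    injectionʳ {β = β} c@(_ , _ , cβ) o = Λ (reify-then β cβ (λ o′ → ∨-introʳ o′ c) (λ _ _ _ → refl)) o tt

    reify-cong : ∀ χ c (o : Over w) {x y : El χ w} → Eq ⟦ χ ⟧ w x y → reify χ c o x ≡ reify χ c o y
    reify-cong (atom p) c                o x≈y         = x≈y
    reify-cong ⊥'       c                o x≈y         = x≈y (code ⊥')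
    reify-cong (α ∧' β) c@(_ , cα , cβ) o (x≈y , x≈y′) =
      cong₂ (∧-intro o c) (reify-cong α cα o x≈y) (reify-cong β cβ o x≈y′)
    reify-cong (α ⊃' β) c@(_ , cα , cβ) o θ≈θ′         =
      cong (⊃-intro o c) (reify-cong β cβ o (θ≈θ′ _ (weaken , reflect α cα o (var here))))
    reify-cong (α ∨' β) c                o x≈y         =
      x≈y (code (α ∨' β)) _ (idW , injectionˡ c o) _ (idW , injectionʳ c o)

    reify-natural : ∀ χ c (o : Over w) (h : Hom u w) (x : El χ w) →
                    reify χ c (restrict h o) (act ⟦ χ ⟧ h x) ≡ actD h (reify χ c o x)
    reify-natural (atom p) c                o h x       = refl
    reify-natural ⊥'       c                o h x       = refl
    reify-natural (α ∧' β) c@(_ , cα , cβ) o h (x , y) =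
      cong₂ (∧-intro (restrict h o) c) (reify-natural α cα o h x) (reify-natural β cβ o h y)
    reify-natural (α ⊃' β) c@(_ , cα , cβ) o h θ =
      trans (cong (⊃-intro (restrict h o) c)
                  (trans (reify-cong β cβ (restrict h o) (apply-fresh-natural α cα o ⟦ β ⟧ h θ))
                         (reify-natural β cβ o (lift h) (apply-fresh α cα o ⟦ β ⟧ θ))))
            (sym (⊃-intro-natural o c h (reify β cβ o (apply-fresh α cα o ⟦ β ⟧ θ))))
    reify-natural (α ∨' β) c o h x =
      trans (η-cong (x z) _ (h∘id≡id∘h , λ _ _ → refl) _ (idW , injectionʳ c (restrict h o)))
      (trans (natural (x z) h (idW , injectionˡ c o) _ (idW , injectionʳ c (restrict h o)))
      (trans (η-cong k _ (h∘id≡id∘h , λ _ _ → refl))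
             (natural k h (idW , injectionʳ c o))))
      where
        z = code (α ∨' β)
        k = η (x z) _ (idW , injectionˡ c o)
        h∘id≡id∘h = trans (∘W-idʳ h) (sym (∘W-idˡ h))

    reflect-natural : ∀ χ c (o : Over w) (h : Hom u w) (d : Derivation w (code χ)) →
                      Eq ⟦ χ ⟧ u (reflect χ c (restrict h o) (actD h d)) (act ⟦ χ ⟧ h (reflect χ c o d))
    reflect-natural (atom p) c                o h d = refl
    reflect-natural ⊥'       c                o h d = λ p → refl
    reflect-natural (α ∧' β) c@(_ , cα , cβ) o h d =
      reflect-natural α cα o h (∧-elimˡ o c d) , reflect-natural β cβ o h (∧-elimʳ o c d)
    reflect-natural (α ⊃' β) c                o h d = Λ-natural (⊃-application c) o h d
    reflect-natural (α ∨' β) c                o h d = λ p → Λ-natural (∨-continuation c p) o h d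

    apply-fresh-natural : ∀ α c (o : Over w) F (h : Hom u w) (θ : ∣ ⟦ α ⟧ ⊃P F ∣ w) →
                          Eq F (u ▷ code α) (apply-fresh α c (restrict h o) F (act (⟦ α ⟧ ⊃P F) h θ))
                                            (act F (lift h) (apply-fresh α c o F θ))
    apply-fresh-natural α c o F h θ = Setoid.trans (obj F _)
      (η-cong θ _ (sym (weaken-lift h) , reflect-natural α c o (lift h) (var here)))
      (natural θ (lift h) (weaken , reflect α c o (var here)))

    ⊃-application : Coded (α ⊃' β) → Operation (atomP (code (α ⊃' β))) ⟦ α ⟧ ⟦ β ⟧
    ⊃-application {α} {β} c@(_ , cα , cβ) = record
      { run         = λ o d x → reflect β cβ o (⊃-elim o c d (reify α cα o x))
      ; run-cong    = λ { o refl x≈y → Setoid.reflexive (obj ⟦ β ⟧ _)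
                            (cong (λ r → reflect β cβ o (⊃-elim o c _ r)) (reify-cong α cα o x≈y)) }
      ; run-natural = λ o h d x → Setoid.trans (obj ⟦ β ⟧ _)
                        (Setoid.reflexive (obj ⟦ β ⟧ _)
                          (cong (λ r → reflect β cβ (restrict h o) (⊃-elim (restrict h o) c (actD h d) r))
                                (reify-natural α cα o h x)))
                        (reflect-natural β cβ o h (⊃-elim o c d (reify α cα o x)))
      }

    ∨-case : Coded (α ∨' β) → ∀ p →
             Operation (atomP (code (α ∨' β)) ×P (⟦ α ⟧ ⊃P atomP p)) (⟦ β ⟧ ⊃P atomP p) (atomP p)
    ∨-case {α} {β} c@(_ , cα , cβ) p = record
      { run         = λ o (d , k₁) k₂ →
          ∨-elim o c d (apply-fresh α cα o (atomP p) k₁) (apply-fresh β cβ o (atomP p) k₂)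
      ; run-cong    = λ { o (refl , k₁≈k₁′) k₂≈k₂′ → cong₂ (∨-elim o c _) (k₁≈k₁′ _ _) (k₂≈k₂′ _ _) }
      ; run-natural = λ o h (d , k₁) k₂ →
          trans (cong₂ (∨-elim (restrict h o) c (actD h d))
                       (apply-fresh-natural α cα o (atomP p) h k₁)
                       (apply-fresh-natural β cβ o (atomP p) h k₂))
                (sym (∨-elim-natural o c h d (apply-fresh α cα o (atomP p) k₁)
                                             (apply-fresh β cβ o (atomP p) k₂)))
      }

    ∨-continuation : Coded (α ∨' β) → ∀ p →
                     Operation (atomP (code (α ∨' β))) (⟦ α ⟧ ⊃P atomP p) ((⟦ β ⟧ ⊃P atomP p) ⊃P atomP p)
    ∨-continuation {α} {β} c p = record
      { run         = λ o d k₁ → Λ (∨-case {α} {β} c p) o (d , k₁)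
      ; run-cong    = λ o {d} {d′} {k₁} {k₁′} d≡d′ k₁≈k₁′ →
                        Λ-cong (∨-case {α} {β} c p) o {d , k₁} {d′ , k₁′} (d≡d′ , k₁≈k₁′)
      ; run-natural = λ o h d k₁ → Λ-natural (∨-case {α} {β} c p) o h (d , k₁)
      }

  hypotheses : ∀ Γ → All Coded Γ → Over w → (∀ {p} → map code Γ ∋ p → ctx w ∋ p) → ∣ ⟦ Γ ⟧c ∣ w
  hypotheses []      []       o ρ = tt
  hypotheses (γ ∷ Γ) (c ∷ cs) o ρ = reflect γ c o (var (ρ here)) , hypotheses Γ cs o (λ x → ρ (there x))

  decode-codes : ∀ Γ → All Coded Γ → map decode (map code Γ) ≡ Γ
  decode-codes []      []       = refl
  decode-codes (γ ∷ Γ) (c ∷ cs) = cong₂ _∷_ (decode-code γ c) (decode-codes Γ cs)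

  complete : ∀ Γ φ → All Coded Γ → Coded φ → ⟦ Γ ⟧c ⇒ ⟦ φ ⟧ → Γ ⊢ φ
  complete Γ φ cs c ⊨φ =
    subst₂ _⊢_ (decode-codes Γ cs) (decode-code φ c)
      (translate (reify φ c over𝒩 (η ⊨φ ⟨ 𝒩 , map code Γ ⟩ (hypotheses Γ cs over𝒩 (λ x → x)))))
    where
      over𝒩 : Over ⟨ 𝒩 , map code Γ ⟩
      over𝒩 = [ (λ m → m) ]

  coded-conjunction : ∀ Γ φ → Coded (foldr _∧'_ φ Γ) → All Coded Γ × Coded φ
  coded-conjunction []      φ c            = [] , c
  coded-conjunction (γ ∷ Γ) φ (_ , cγ , c) = let cs , cφ = coded-conjunction Γ φ c in cγ ∷ cs , cφ

subformulas : Form → List Form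
subformulas (atom p) = atom p ∷ []
subformulas ⊥'       = ⊥' ∷ []
subformulas (α ∧' β) = (α ∧' β) ∷ subformulas α ++ subformulas β
subformulas (α ∨' β) = (α ∨' β) ∷ subformulas α ++ subformulas β
subformulas (α ⊃' β) = (α ⊃' β) ∷ subformulas α ++ subformulas β

atom-bound : Form → ℕ
atom-bound (atom p) = suc p
atom-bound ⊥'       = 0
atom-bound (α ∧' β) = atom-bound α + atom-bound β
atom-bound (α ∨' β) = atom-bound α + atom-bound β
atom-bound (α ⊃' β) = atom-bound α + atom-bound β

-- Junk values: position χ L = length L if χ ∉ L, and L ! n = ⊥' if n ≥ length L.
position : Form → List Form → ℕ
position χ []      = 0
position χ (γ ∷ L) with χ ≟ᶠ γ
... | yes _ = 0
... | no _  = suc (position χ L)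

_!_ : List Form → ℕ → Form
[]      ! _     = ⊥'
(γ ∷ L) ! zero  = γ
(γ ∷ L) ! suc n = L ! n

!-position : ∀ L → χ ∈ L → L ! position χ L ≡ χ
!-position {χ} (γ ∷ L) χ∈γL with χ ≟ᶠ γ
... | yes χ≡γ = sym χ≡γ
... | no χ≢γ  = !-position L (tail χ≢γ χ∈γL)

module Encoding (ψ : Form) where

  -- Atoms below N stand for themselves, N + i for the i-th subformula of ψ.
  N : ℕ
  N = atom-bound ψ

  decode : Atom → Form
  decode n with n <? N
  ... | yes _ = atom n
  ... | no _  = subformulas ψ ! (n ∸ N)

  label : Form → Atom
  label χ = N + position χ (subformulas ψ)

  open Reification decode label public

  decode-atom : p < N → decode p ≡ atom p
  decode-atom {p} p<N with p <? N
  ... | yes _   = refl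
  ... | no p≮N = contradiction p<N p≮N

  decode-label : χ ∈ subformulas ψ → decode (label χ) ≡ χ
  decode-label {χ} χ∈ψ with label χ <? N
  ... | yes label<N = contradiction label<N (ℕ.m+n≮m N _)
  ... | no _        = trans (cong (subformulas ψ !_) (ℕ.m+n∸m≡n N _)) (!-position (subformulas ψ) χ∈ψ)

  compound : (_∙_ : Form → Form → Form) → α ∙ β ∈ subformulas ψ → Coded α × Coded β →
             (decode (label (α ∙ β)) ≡ decode (code α) ∙ decode (code β)) × Coded α × Coded β
  compound {α} {β} _∙_ α∙β∈ψ (cα , cβ) =
    trans (decode-label α∙β∈ψ) (sym (cong₂ _∙_ (decode-code α cα) (decode-code β cβ))) , cα , cβ

  mutual
    coded : ∀ χ → atom-bound χ ≤ N → subformulas χ ⊆ subformulas ψ → Coded χ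
    coded (atom p) p<N _ = decode-atom p<N
    coded ⊥'       _   s = decode-label (s (here refl))
    coded (α ∧' β) b   s = compound _∧'_ (s (here refl)) (coded-components α β b s)
    coded (α ∨' β) b   s = compound _∨'_ (s (here refl)) (coded-components α β b s)
    coded (α ⊃' β) b   s = compound _⊃'_ (s (here refl)) (coded-components α β b s)

    coded-components : ∀ α β → atom-bound α + atom-bound β ≤ N →
                       (χ ∷ subformulas α ++ subformulas β) ⊆ subformulas ψ → Coded α × Coded β
    coded-components α β b s = coded α (ℕ.m+n≤o⇒m≤o _ b) (λ m → s (there (∈-++⁺ˡ m)))
                             , coded β (ℕ.m+n≤o⇒n≤o _ b) (λ m → s (there (∈-++⁺ʳ _ m)))

  ψ-coded : Coded ψ
  ψ-coded = coded ψ ℕ.≤-refl (λ m → m)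

theorem22 : (Γ : List Form) (φ : Form) → (⟦ Γ ⟧c ⇒ ⟦ φ ⟧) → Γ ⊢ φ
theorem22 Γ φ = uncurry (complete Γ φ) (coded-conjunction Γ φ ψ-coded)
  where open Encoding (foldr _∧'_ φ Γ)
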